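{- Let $n\geq 1$ and let $W$ be a binary word of length $2n$ with exactly two occurrences of $\mathtt{1}$. Then $W$ is a shuffle square if and only if $W$ contains one of the following factors: (i) a prefix of the form $\mathtt{0}^j\mathtt{11}$ (with $j\geq 0$) which has even length; or (ii) a factor of the form $\mathtt{1}\mathtt{0}^j\mathtt{1}$ (with $j\geq 1$) whose length $l=j+2$ satisfies $3\leq l\leq n+1$.
   Context: Binary words are over $\{\mathtt{0},\mathtt{1}\}$; $\mathtt{0}^j$ denotes a run of $j$ copies of $\mathtt{0}$. A \emph{factor} of $W$ is a word $F$ with $W=PFS$ for some (possibly empty) words $P,S$; $PF$ is then a \emph{prefix}. A \emph{shuffle square} is a word whose positions can be partitioned into two sets so that the two resulting subwords (letters at those positions, in order) are identical. -}

module Defs where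

open import Data.Nat using (ℕ; zero; suc; _+_; _*_; _≤_)
open import Data.List using (List; []; _∷_; _++_; length; replicate)
open import Data.Product using (Σ; _×_; ∃; _,_)
open import Relation.Binary.PropositionalEquality using (_≡_)

data Bit : Set where
  b0 b1 : Bit

Word : Set
Word = List Bit

count1 : Word → ℕ
count1 [] = 0
count1 (b0 ∷ w) = count1 w
count1 (b1 ∷ w) = suc (count1 w)

zeros : ℕ → Word
zeros j = replicate j b0

Factor : Word → Word → Set
Factor F W = Σ Word λ P → Σ Word λ S → W ≡ P ++ F ++ S

Prefix : Word → Word → Set
Prefix F W = Σ Word λ S → W ≡ F ++ S

-- The subword of w at the positions marked 'in' (b1) resp. 'out' (b0)
-- by a mask of the same length (extra letters beyond the mask are dropped,
-- but the mask is required to have the same length as the word).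
pick : Bit → List Bit → Word → Word
pick c [] w = []
pick c (m ∷ ms) [] = []
pick b0 (b0 ∷ ms) (x ∷ w) = x ∷ pick b0 ms w
pick b0 (b1 ∷ ms) (x ∷ w) = pick b0 ms w
pick b1 (b0 ∷ ms) (x ∷ w) = pick b1 ms w
pick b1 (b1 ∷ ms) (x ∷ w) = x ∷ pick b1 ms w

-- Shuffle square: the positions of W can be partitioned into two sets
-- (encoded by a mask of length |W|) whose induced subwords are identical.
ShuffleSquare : Word → Set
ShuffleSquare W = Σ (List Bit) λ mask →
  (length mask ≡ length W) × (pick b1 mask W ≡ pick b0 mask W)

{-# OPTIONS --safe #-}
module Submission where

open import Defs
open import Data.Nat using (ℕ; zero; suc; _+_; _*_; _≤_; z≤n; s≤s)
open import Data.Nat.Properties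
open import Data.Nat.Divisibility using (_∣_; divides; ∣-refl; ∣m+n∣m⇒∣n)
open import Data.Nat.Tactic.RingSolver using (solve-∀)
open import Data.List using (List; []; _∷_; _++_; [_]; length)
open import Data.List.Properties using (∷-injectiveʳ; ++-assoc; length-++; length-replicate)
open import Data.Product using (Σ; _×_; _,_; proj₁; proj₂)
open import Data.Sum using (_⊎_; inj₁; inj₂; map₂)
open import Data.Empty using (⊥-elim)
open import Function.Bundles using (_⇔_; mk⇔)
open import Function.Properties.Equivalence using () renaming (trans to ⇔-trans)
open import Relation.Nullary using (contradiction)
open import Relation.Binary.PropositionalEquality hiding ([_])

-- Write W = 0^a 1 0^b 1 0^c. The two 1s of a shuffle square lie in different halves, so
-- both halves equal 0^i 1 0^j, and counting the zeros each half takes from the three blocks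
-- gives a decomposition a = (u+v)+u, b = w+v, c = t+(w+t). Such a decomposition exists iff
-- a + c = b + 2e for some e, except when b = 0 and a is odd: for e = 0 take u = t = 0, and
-- each further pair of zeros is absorbed by u or t. As a + b + c + 2 = 2n, this says
-- "b = 0 and a even, or 1 ≤ b ≤ n - 1", i.e. W has the factor 0^a 11 or 1 0^b 1.

twoOnes : ℕ → ℕ → ℕ → Word
twoOnes a b c = zeros a ++ b1 ∷ zeros b ++ b1 ∷ zeros c

+-suc-suc : ∀ m n → m + suc (suc n) ≡ suc (suc (m + n))
+-suc-suc m n = trans (+-suc m (suc n)) (cong suc (+-suc m n))

zeros-++ : ∀ p q → zeros p ++ zeros q ≡ zeros (p + q)
zeros-++ zero    q = refl
zeros-++ (suc p) q = cong (b0 ∷_) (zeros-++ p q)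

zeros-++-assoc : ∀ p q w → zeros p ++ zeros q ++ w ≡ zeros (p + q) ++ w
zeros-++-assoc p q w = trans (sym (++-assoc (zeros p) (zeros q) w)) (cong (_++ w) (zeros-++ p q))

zeros-injective : ∀ {p q} → zeros p ≡ zeros q → p ≡ q
zeros-injective {p} {q} eq = trans (sym (length-replicate p)) (trans (cong length eq) (length-replicate q))

zeros-1-injective : ∀ p q {u v : Word} →
  zeros p ++ b1 ∷ u ≡ zeros q ++ b1 ∷ v → p ≡ q × u ≡ v
zeros-1-injective zero    zero    refl = refl , refl
zeros-1-injective (suc p) (suc q) eq with zeros-1-injective p q (∷-injectiveʳ eq)
... | p≡q , u≡v = cong suc p≡q , u≡v

length-zeros++ : ∀ j (w : Word) → length (zeros j ++ w) ≡ j + length w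
length-zeros++ j w = trans (length-++ (zeros j)) (cong (_+ length w) (length-replicate j))

length-++-∷-++-∷ : ∀ {A : Set} (xs : List A) y ys z zs {a b c} →
  length xs ≡ a → length ys ≡ b → length zs ≡ c →
  length (xs ++ y ∷ ys ++ z ∷ zs) ≡ a + suc (b + suc c)
length-++-∷-++-∷ xs y ys z zs refl refl refl =
  trans (length-++ xs) (cong (λ ℓ → length xs + suc ℓ) (length-++ ys))

length-twoOnes : ∀ a b c → length (twoOnes a b c) ≡ a + suc (b + suc c)
length-twoOnes a b c = length-++-∷-++-∷ (zeros a) b1 (zeros b) b1 (zeros c)
  (length-replicate a) (length-replicate b) (length-replicate c)

count1-++ : ∀ u v → count1 (u ++ v) ≡ count1 u + count1 v
count1-++ []       v = refl
count1-++ (b0 ∷ u) v = count1-++ u v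
count1-++ (b1 ∷ u) v = cong suc (count1-++ u v)

count1-zeros : ∀ k → count1 (zeros k) ≡ 0
count1-zeros zero    = refl
count1-zeros (suc k) = count1-zeros k

count1-zeros++ : ∀ k w → count1 (zeros k ++ w) ≡ count1 w
count1-zeros++ zero    w = refl
count1-zeros++ (suc k) w = count1-zeros++ k w

count1-twoOnes : ∀ a b c → count1 (twoOnes a b c) ≡ 2
count1-twoOnes a b c =
  trans (count1-zeros++ a _) (cong suc (trans (count1-zeros++ b _) (cong suc (count1-zeros c))))

count1≡0⇒zeros : ∀ w → count1 w ≡ 0 → w ≡ zeros (length w)
count1≡0⇒zeros []       _ = refl
count1≡0⇒zeros (b0 ∷ w) h = cong (b0 ∷_) (count1≡0⇒zeros w h)

first-one : ∀ w {k} → count1 w ≡ suc k →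
  Σ ℕ λ a → Σ Word λ w′ → w ≡ zeros a ++ b1 ∷ w′ × count1 w′ ≡ k
first-one (b0 ∷ w) h with first-one w h
... | a , w′ , refl , h′ = suc a , w′ , refl , h′
first-one (b1 ∷ w) h = 0 , w , refl , suc-injective h

count1≡2⇒twoOnes : ∀ W → count1 W ≡ 2 →
  Σ ℕ λ a → Σ ℕ λ b → Σ ℕ λ c → W ≡ twoOnes a b c
count1≡2⇒twoOnes W h with first-one W h
... | a , W′ , refl , h′ with first-one W′ h′
...   | b , W″ , refl , h″ =
  a , b , length W″ , cong (λ w → zeros a ++ b1 ∷ zeros b ++ b1 ∷ w) (count1≡0⇒zeros W″ h″)

twoOnes≢zeros³ : ∀ x₁ x₂ x₃ y₁ y₂ y₃ →
  twoOnes x₁ x₂ x₃ ≢ zeros y₁ ++ zeros y₂ ++ zeros y₃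
twoOnes≢zeros³ x₁ x₂ x₃ y₁ y₂ y₃ eq with
  trans (sym (count1-twoOnes x₁ x₂ x₃))
    (trans (cong count1 (trans eq (trans (zeros-++-assoc y₁ y₂ _) (zeros-++ (y₁ + y₂) y₃))))
      (count1-zeros (y₁ + y₂ + y₃)))
... | ()

count : Bit → List Bit → ℕ
count c []        = 0
count b0 (b0 ∷ m) = suc (count b0 m)
count b0 (b1 ∷ m) = count b0 m
count b1 (b0 ∷ m) = count b1 m
count b1 (b1 ∷ m) = suc (count b1 m)

count-b1+count-b0 : ∀ m → count b1 m + count b0 m ≡ length m
count-b1+count-b0 []       = refl
count-b1+count-b0 (b0 ∷ m) = trans (+-suc (count b1 m) (count b0 m)) (cong suc (count-b1+count-b0 m))
count-b1+count-b0 (b1 ∷ m) = cong suc (count-b1+count-b0 m)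

pick-++ : ∀ c m₁ m₂ (x y : Word) → length m₁ ≡ length x →
  pick c (m₁ ++ m₂) (x ++ y) ≡ pick c m₁ x ++ pick c m₂ y
pick-++ c  []        m₂ []      y _ = refl
pick-++ b0 (b0 ∷ m₁) m₂ (z ∷ x) y h = cong (z ∷_) (pick-++ b0 m₁ m₂ x y (suc-injective h))
pick-++ b0 (b1 ∷ m₁) m₂ (z ∷ x) y h = pick-++ b0 m₁ m₂ x y (suc-injective h)
pick-++ b1 (b0 ∷ m₁) m₂ (z ∷ x) y h = pick-++ b1 m₁ m₂ x y (suc-injective h)
pick-++ b1 (b1 ∷ m₁) m₂ (z ∷ x) y h = cong (z ∷_) (pick-++ b1 m₁ m₂ x y (suc-injective h))

pick-zeros : ∀ c m → pick c m (zeros (length m)) ≡ zeros (count c m)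
pick-zeros c  []       = refl
pick-zeros b0 (b0 ∷ m) = cong (b0 ∷_) (pick-zeros b0 m)
pick-zeros b0 (b1 ∷ m) = pick-zeros b0 m
pick-zeros b1 (b0 ∷ m) = pick-zeros b1 m
pick-zeros b1 (b1 ∷ m) = cong (b0 ∷_) (pick-zeros b1 m)

pick-zeros++ : ∀ c m m′ {k} (w : Word) → length m ≡ k →
  pick c (m ++ m′) (zeros k ++ w) ≡ zeros (count c m) ++ pick c m′ w
pick-zeros++ c m m′ w refl =
  trans (pick-++ c m m′ (zeros (length m)) w (sym (length-replicate _)))
    (cong (_++ pick c m′ w) (pick-zeros c m))

pick-twoOnes : ∀ c m₁ e m₂ f m₃ {a b k} →
  length m₁ ≡ a → length m₂ ≡ b → length m₃ ≡ k →
  pick c (m₁ ++ e ∷ m₂ ++ f ∷ m₃) (twoOnes a b k)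
    ≡ zeros (count c m₁) ++ pick c [ e ] [ b1 ] ++
      zeros (count c m₂) ++ pick c [ f ] [ b1 ] ++ zeros (count c m₃)
pick-twoOnes c m₁ e m₂ f m₃ {k = k} ℓ₁ ℓ₂ refl = begin
  pick c (m₁ ++ e ∷ m₂ ++ f ∷ m₃) (twoOnes _ _ _)
    ≡⟨ pick-zeros++ c m₁ _ _ ℓ₁ ⟩
  zeros (count c m₁) ++ pick c ([ e ] ++ m₂ ++ f ∷ m₃) ([ b1 ] ++ zeros _ ++ b1 ∷ zeros k)
    ≡⟨ cong (zeros (count c m₁) ++_) (pick-++ c [ e ] _ [ b1 ] _ refl) ⟩
  zeros (count c m₁) ++ pick c [ e ] [ b1 ] ++ pick c (m₂ ++ f ∷ m₃) (zeros _ ++ b1 ∷ zeros k)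
    ≡⟨ cong (λ w → zeros (count c m₁) ++ pick c [ e ] [ b1 ] ++ w)
         (trans (pick-zeros++ c m₂ _ _ ℓ₂) (cong (zeros (count c m₂) ++_)
           (trans (pick-++ c [ f ] m₃ [ b1 ] _ refl)
             (cong (pick c [ f ] [ b1 ] ++_) (pick-zeros c m₃))))) ⟩
  zeros (count c m₁) ++ pick c [ e ] [ b1 ] ++
    zeros (count c m₂) ++ pick c [ f ] [ b1 ] ++ zeros (count c m₃) ∎
  where open ≡-Reasoning

split-by-length : ∀ {A : Set} (xs : List A) k {n} → length xs ≡ k + n →
  Σ (List A) λ ys → Σ (List A) λ zs → xs ≡ ys ++ zs × length ys ≡ k × length zs ≡ n
split-by-length xs       zero    h = [] , xs , refl , refl , h
split-by-length (x ∷ xs) (suc k) h with split-by-length xs k (suc-injective h)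
... | ys , zs , refl , refl , ℓ = x ∷ ys , zs , refl , refl , ℓ

-- 0^a 1 0^b 1 0^c as a shuffle of two copies of 0^(u+v) 1 0^(w+t): the copy holding the
-- first 1 takes u+v, w and t zeros from the three blocks, the other copy u, v and w+t.
record Split (a b c : ℕ) : Set where
  constructor split
  field
    u v w t : ℕ
    a≡ : a ≡ (u + v) + u
    b≡ : b ≡ w + v
    c≡ : c ≡ t + (w + t)

split-2+ˡ : ∀ {a b c} → Split a b c → Split (2 + a) b c
split-2+ˡ (split u v w t a≡ b≡ c≡) =
  split (suc u) v w t (trans (cong (2 +_) a≡) (cong suc (sym (+-suc (u + v) u)))) b≡ c≡

split-2+ʳ : ∀ {a b c} → Split a b c → Split a b (2 + c)
split-2+ʳ (split u v w t a≡ b≡ c≡) =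
  split u v w (suc t) a≡ b≡
    (trans (cong (2 +_) c≡) (cong suc (sym (trans (cong (t +_) (+-suc w t)) (+-suc t (w + t))))))

ordered-halves⇒split : ∀ {a b c} x₁ x₂ x₃ y₁ y₂ y₃ →
  x₁ + y₁ ≡ a → x₂ + y₂ ≡ b → x₃ + y₃ ≡ c →
  zeros x₁ ++ b1 ∷ zeros x₂ ++ zeros x₃ ≡ zeros y₁ ++ zeros y₂ ++ b1 ∷ zeros y₃ → Split a b c
ordered-halves⇒split x₁ x₂ x₃ y₁ y₂ y₃ refl refl refl eq
  with zeros-1-injective x₁ (y₁ + y₂) (trans eq (zeros-++-assoc y₁ y₂ _))
... | refl , tails with zeros-injective (trans (sym (zeros-++ x₂ x₃)) tails)
... | refl = split y₁ y₂ x₂ x₃ refl refl refl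

halves⇒split : ∀ {a b c} e f x₁ x₂ x₃ y₁ y₂ y₃ →
  x₁ + y₁ ≡ a → x₂ + y₂ ≡ b → x₃ + y₃ ≡ c →
  zeros x₁ ++ pick b1 [ e ] [ b1 ] ++ zeros x₂ ++ pick b1 [ f ] [ b1 ] ++ zeros x₃
    ≡ zeros y₁ ++ pick b0 [ e ] [ b1 ] ++ zeros y₂ ++ pick b0 [ f ] [ b1 ] ++ zeros y₃ →
  Split a b c
halves⇒split b1 b1 x₁ x₂ x₃ y₁ y₂ y₃ _ _ _ eq =
  ⊥-elim (twoOnes≢zeros³ x₁ x₂ x₃ y₁ y₂ y₃ eq)
halves⇒split b0 b0 x₁ x₂ x₃ y₁ y₂ y₃ _ _ _ eq =
  ⊥-elim (twoOnes≢zeros³ y₁ y₂ y₃ x₁ x₂ x₃ (sym eq))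
halves⇒split b1 b0 x₁ x₂ x₃ y₁ y₂ y₃ h₁ h₂ h₃ eq =
  ordered-halves⇒split x₁ x₂ x₃ y₁ y₂ y₃ h₁ h₂ h₃ eq
halves⇒split b0 b1 x₁ x₂ x₃ y₁ y₂ y₃ h₁ h₂ h₃ eq =
  ordered-halves⇒split y₁ y₂ y₃ x₁ x₂ x₃
    (trans (+-comm y₁ x₁) h₁) (trans (+-comm y₂ x₂) h₂) (trans (+-comm y₃ x₃) h₃) (sym eq)

shuffleSquare⇒split : ∀ a b c → ShuffleSquare (twoOnes a b c) → Split a b c
shuffleSquare⇒split a b c (m , |m| , halves) with split-by-length m a (trans |m| (length-twoOnes a b c))
... | m₁ , e ∷ m′ , refl , ℓ₁ , |m′| with split-by-length m′ b (suc-injective |m′|)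
...   | m₂ , f ∷ m₃ , refl , ℓ₂ , |m₃| =
  halves⇒split e f (count b1 m₁) (count b1 m₂) (count b1 m₃) (count b0 m₁) (count b0 m₂) (count b0 m₃)
    (sizes m₁ ℓ₁) (sizes m₂ ℓ₂) (sizes m₃ ℓ₃)
    (trans (sym (pick-twoOnes b1 m₁ e m₂ f m₃ ℓ₁ ℓ₂ ℓ₃))
      (trans halves (pick-twoOnes b0 m₁ e m₂ f m₃ ℓ₁ ℓ₂ ℓ₃)))
  where
  ℓ₃ = suc-injective |m₃|
  sizes : ∀ m {k} → length m ≡ k → count b1 m + count b0 m ≡ k
  sizes m = trans (count-b1+count-b0 m)

block : ℕ → ℕ → List Bit
block (suc x) y       = b1 ∷ block x y
block zero    (suc y) = b0 ∷ block zero y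
block zero    zero    = []

length-block : ∀ x y → length (block x y) ≡ x + y
length-block (suc x) y       = cong suc (length-block x y)
length-block zero    (suc y) = cong suc (length-block zero y)
length-block zero    zero    = refl

count-b1-block : ∀ x y → count b1 (block x y) ≡ x
count-b1-block (suc x) y       = cong suc (count-b1-block x y)
count-b1-block zero    (suc y) = count-b1-block zero y
count-b1-block zero    zero    = refl

count-b0-block : ∀ x y → count b0 (block x y) ≡ y
count-b0-block (suc x) y       = count-b0-block x y
count-b0-block zero    (suc y) = cong suc (count-b0-block zero y)
count-b0-block zero    zero    = refl

split⇒shuffleSquare : ∀ {a b c} → Split a b c → ShuffleSquare (twoOnes a b c)
split⇒shuffleSquare (split u v w t refl refl refl) = mask , |mask| , trans half₁ (sym half₀)
  where
  open ≡-Reasoning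
  m₁ = block (u + v) u
  m₂ = block w v
  m₃ = block t (w + t)
  mask = m₁ ++ b1 ∷ m₂ ++ b0 ∷ m₃
  ℓ₁ = length-block (u + v) u
  ℓ₂ = length-block w v
  ℓ₃ = length-block t (w + t)

  |mask| : length mask ≡ length (twoOnes ((u + v) + u) (w + v) (t + (w + t)))
  |mask| = trans (length-++-∷-++-∷ m₁ b1 m₂ b0 m₃ ℓ₁ ℓ₂ ℓ₃) (sym (length-twoOnes _ _ _))

  half₁ : pick b1 mask (twoOnes _ _ _) ≡ zeros (u + v) ++ b1 ∷ zeros (w + t)
  half₁ = begin
    pick b1 mask (twoOnes _ _ _)
      ≡⟨ pick-twoOnes b1 m₁ b1 m₂ b0 m₃ ℓ₁ ℓ₂ ℓ₃ ⟩
    zeros (count b1 m₁) ++ b1 ∷ zeros (count b1 m₂) ++ zeros (count b1 m₃)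
      ≡⟨ cong₂ (λ p q → zeros p ++ b1 ∷ q) (count-b1-block (u + v) u)
           (cong₂ (λ p q → zeros p ++ zeros q) (count-b1-block w v) (count-b1-block t (w + t))) ⟩
    zeros (u + v) ++ b1 ∷ zeros w ++ zeros t
      ≡⟨ cong (λ q → zeros (u + v) ++ b1 ∷ q) (zeros-++ w t) ⟩
    zeros (u + v) ++ b1 ∷ zeros (w + t) ∎

  half₀ : pick b0 mask (twoOnes _ _ _) ≡ zeros (u + v) ++ b1 ∷ zeros (w + t)
  half₀ = begin
    pick b0 mask (twoOnes _ _ _)
      ≡⟨ pick-twoOnes b0 m₁ b1 m₂ b0 m₃ ℓ₁ ℓ₂ ℓ₃ ⟩
    zeros (count b0 m₁) ++ zeros (count b0 m₂) ++ b1 ∷ zeros (count b0 m₃)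
      ≡⟨ cong₂ (λ p q → zeros p ++ q) (count-b0-block (u + v) u)
           (cong₂ (λ p q → zeros p ++ b1 ∷ zeros q)
             (count-b0-block w v) (count-b0-block t (w + t))) ⟩
    zeros u ++ zeros v ++ b1 ∷ zeros (w + t)
      ≡⟨ zeros-++-assoc u v _ ⟩
    zeros (u + v) ++ b1 ∷ zeros (w + t) ∎

shuffleSquare⇔split : ∀ a b c → ShuffleSquare (twoOnes a b c) ⇔ Split a b c
shuffleSquare⇔split a b c = mk⇔ (shuffleSquare⇒split a b c) split⇒shuffleSquare

split-gap-≤ : ∀ {a b c} → Split a b c → b ≤ a + c
split-gap-≤ (split u v w t refl refl refl) =
  ≤-trans (m≤m+n (w + v) ((u + u) + (t + t))) (≤-reflexive (rearrange u v w t))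
  where
  rearrange : ∀ u v w t → (w + v) + ((u + u) + (t + t)) ≡ ((u + v) + u) + (t + (w + t))
  rearrange = solve-∀

gap-bound : ∀ {a b c n} → b ≤ a + c → a + suc (b + suc c) ≡ 2 * n → b + 2 ≤ n + 1
gap-bound {a} {b} {c} {n} b≤a+c len = begin
  b + 2     ≡⟨ +-assoc b 1 1 ⟨
  b + 1 + 1 ≤⟨ +-monoˡ-≤ 1 (*-cancelˡ-≤ 2 twice) ⟩
  n + 1     ∎
  where
  open ≤-Reasoning
  twice : 2 * (b + 1) ≤ 2 * n
  twice = begin
    2 * (b + 1)         ≡⟨ lhs b ⟩
    b + (b + 2)         ≤⟨ +-monoˡ-≤ (b + 2) b≤a+c ⟩
    (a + c) + (b + 2)   ≡⟨ rhs a b c ⟩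
    a + suc (b + suc c) ≡⟨ len ⟩
    2 * n               ∎
    where
    lhs : ∀ b → 2 * (b + 1) ≡ b + (b + 2)
    lhs = solve-∀
    rhs : ∀ a b c → (a + c) + (b + 2) ≡ a + suc (b + suc c)
    rhs = solve-∀

Criterion : ℕ → ℕ → ℕ → Set
Criterion n a b = (b ≡ 0 × 2 ∣ a) ⊎ (1 ≤ b × b + 2 ≤ n + 1)

split⇒criterion : ∀ {a b c n} → a + suc (b + suc c) ≡ 2 * n → Split a b c → Criterion n a b
split⇒criterion {b = suc b} len s = inj₂ (s≤s z≤n , gap-bound (split-gap-≤ s) len)
split⇒criterion {b = zero}  len (split u v w t a≡ b≡ _) with m+n≡0⇒n≡0 w (sym b≡)
... | refl = inj₁ (refl , divides u (trans a≡ (double u)))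
  where
  double : ∀ u → (u + 0) + u ≡ u * 2
  double = solve-∀

-- Each pair of surplus zeros goes to u or t; both blocks are too small only for a = c = 1,
-- b = 0, which the side condition excludes.
split-of-surplus : ∀ e a b c → a + c ≡ e * 2 + b → 1 ≤ b ⊎ 2 ∣ a → Split a b c
split-of-surplus zero a b c h _ =
  split 0 a c 0 (sym (+-identityʳ a)) (trans (sym h) (+-comm a c)) (sym (+-identityʳ c))
split-of-surplus (suc e) (suc (suc a)) b c h cond =
  split-2+ˡ (split-of-surplus e a b c (suc-injective (suc-injective h))
    (map₂ (λ 2∣2+a → ∣m+n∣m⇒∣n 2∣2+a ∣-refl) cond))
split-of-surplus (suc e) a b (suc (suc c)) h cond =
  split-2+ʳ (split-of-surplus e a b c (suc-injective (suc-injective (trans (sym (+-suc-suc a c)) h))) cond)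
split-of-surplus (suc e) 0 b 0 () _
split-of-surplus (suc e) 0 b 1 () _
split-of-surplus (suc e) 1 b 0 () _
split-of-surplus (suc e) 1 b 1 h (inj₁ 1≤b) =
  contradiction (m+n≡0⇒n≡0 (e * 2) (sym (suc-injective (suc-injective h)))) (>⇒≢ 1≤b)
split-of-surplus (suc e) 1 b 1 h (inj₂ (divides zero ()))
split-of-surplus (suc e) 1 b 1 h (inj₂ (divides (suc q) ()))

length⇒surplus : ∀ a b c e → a + suc (b + suc c) ≡ 2 * (b + 1 + e) → a + c ≡ e * 2 + b
length⇒surplus a b c e len = +-cancelʳ-≡ (b + 2) (a + c) (e * 2 + b) (begin
  (a + c) + (b + 2)   ≡⟨ lhs a b c ⟩
  a + suc (b + suc c) ≡⟨ len ⟩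
  2 * (b + 1 + e)     ≡⟨ rhs b e ⟩
  (e * 2 + b) + (b + 2) ∎)
  where
  open ≡-Reasoning
  lhs : ∀ a b c → (a + c) + (b + 2) ≡ a + suc (b + suc c)
  lhs = solve-∀
  rhs : ∀ b e → 2 * (b + 1 + e) ≡ (e * 2 + b) + (b + 2)
  rhs = solve-∀

criterion⇒split : ∀ {a b c n} → 1 ≤ n → a + suc (b + suc c) ≡ 2 * n →
  Criterion n a b → Split a b c
criterion⇒split {a} {c = c} {suc n} _ len (inj₁ (refl , 2∣a)) =
  split-of-surplus n a 0 c (length⇒surplus a 0 c n len) (inj₂ 2∣a)
criterion⇒split {a} {b} {c} {n} _ len (inj₂ (1≤b , b+2≤n+1))
  with m≤n⇒∃[o]m+o≡n (+-cancelʳ-≤ 1 (b + 1) _ (subst (_≤ n + 1) (sym (+-assoc b 1 1)) b+2≤n+1))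
... | e , refl = split-of-surplus e a b c (length⇒surplus a b c e len) (inj₁ 1≤b)

split⇔criterion : ∀ {a b c n} → 1 ≤ n → a + suc (b + suc c) ≡ 2 * n →
  Split a b c ⇔ Criterion n a b
split⇔criterion 1≤n len = mk⇔ (split⇒criterion len) (criterion⇒split 1≤n len)

HasCriticalFactor : ℕ → Word → Set
HasCriticalFactor n W =
  (Σ ℕ λ j → Σ ℕ λ k →
    (length (zeros j ++ b1 ∷ b1 ∷ []) ≡ 2 * k) × Prefix (zeros j ++ b1 ∷ b1 ∷ []) W)
  ⊎ (Σ ℕ λ j → 1 ≤ j × 3 ≤ j + 2 × j + 2 ≤ n + 1 × Factor (b1 ∷ zeros j ++ b1 ∷ []) W)

criterion⇒factor : ∀ {a b c n} → Criterion n a b → HasCriticalFactor n (twoOnes a b c)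
criterion⇒factor {a} {c = c} (inj₁ (refl , divides q a≡q*2)) =
  inj₁ (a , suc q , trans (length-zeros++ a _) (trans (cong (_+ 2) a≡q*2) (even q)) ,
        zeros c , sym (++-assoc (zeros a) (b1 ∷ b1 ∷ []) (zeros c)))
  where
  even : ∀ q → q * 2 + 2 ≡ 2 * suc q
  even = solve-∀
criterion⇒factor {a} {b} {c} (inj₂ (1≤b , b+2≤n+1)) =
  inj₂ (b , 1≤b , +-monoˡ-≤ 2 1≤b , b+2≤n+1 , zeros a , zeros c ,
        cong (λ w → zeros a ++ b1 ∷ w) (sym (++-assoc (zeros b) [ b1 ] (zeros c))))

prefix-twoOnes : ∀ a b c j S → twoOnes a b c ≡ (zeros j ++ b1 ∷ b1 ∷ []) ++ S → a ≡ j × b ≡ 0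
prefix-twoOnes a b c j S eq with zeros-1-injective a j (trans eq (++-assoc (zeros j) (b1 ∷ b1 ∷ []) S))
... | a≡j , tail = a≡j , proj₁ (zeros-1-injective b 0 tail)

factor-twoOnes : ∀ a b c j P S → twoOnes a b c ≡ P ++ (b1 ∷ zeros j ++ [ b1 ]) ++ S → b ≡ j
factor-twoOnes a b c j P S eq =
  proj₁ (zeros-1-injective b j (proj₂ (zeros-1-injective a (length P) (trans eq′ P≡zeros))))
  where
  open ≡-Reasoning
  eq′ : twoOnes a b c ≡ P ++ b1 ∷ zeros j ++ b1 ∷ S
  eq′ = trans eq (cong (λ w → P ++ b1 ∷ w) (++-assoc (zeros j) [ b1 ] S))
  #P≡0 : count1 P ≡ 0
  #P≡0 = m+n≡0⇒m≡0 (count1 P) (suc-injective (suc-injective (begin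
    suc (suc (count1 P + count1 S))            ≡⟨ +-suc-suc (count1 P) (count1 S) ⟨
    count1 P + suc (suc (count1 S))            ≡⟨ cong (λ k → count1 P + suc k) (count1-zeros++ j _) ⟨
    count1 P + count1 (b1 ∷ zeros j ++ b1 ∷ S) ≡⟨ count1-++ P _ ⟨
    count1 (P ++ b1 ∷ zeros j ++ b1 ∷ S)       ≡⟨ cong count1 eq′ ⟨
    count1 (twoOnes a b c)                     ≡⟨ count1-twoOnes a b c ⟩
    2                                          ∎)))
  P≡zeros : P ++ b1 ∷ zeros j ++ b1 ∷ S ≡ zeros (length P) ++ b1 ∷ zeros j ++ b1 ∷ S
  P≡zeros = cong (_++ b1 ∷ zeros j ++ b1 ∷ S) (count1≡0⇒zeros P #P≡0)

factor⇒criterion : ∀ {a b c n} → HasCriticalFactor n (twoOnes a b c) → Criterion n a b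
factor⇒criterion {a} {b} {c} (inj₁ (j , k , len , S , eq)) with prefix-twoOnes a b c j S eq
... | refl , b≡0 = inj₁ (b≡0 , ∣m+n∣m⇒∣n (divides k 2+a≡k*2) ∣-refl)
  where
  2+a≡k*2 : 2 + a ≡ k * 2
  2+a≡k*2 = trans (+-comm 2 a) (trans (sym (length-zeros++ a _)) (trans len (*-comm 2 k)))
factor⇒criterion {a} {b} {c} (inj₂ (j , 1≤j , _ , j+2≤n+1 , P , S , eq))
  with factor-twoOnes a b c j P S eq
... | refl = inj₂ (1≤j , j+2≤n+1)

criterion⇔factor : ∀ {a b c n} → Criterion n a b ⇔ HasCriticalFactor n (twoOnes a b c)
criterion⇔factor = mk⇔ criterion⇒factor factor⇒criterion

theorem9 : (n : ℕ) → 1 ≤ n → (W : Word) → length W ≡ 2 * n → count1 W ≡ 2 →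
  ShuffleSquare W ⇔
    ((Σ ℕ λ j → Σ ℕ λ k → (length (zeros j ++ b1 ∷ b1 ∷ []) ≡ 2 * k) × Prefix (zeros j ++ b1 ∷ b1 ∷ []) W)
     ⊎ (Σ ℕ λ j → 1 ≤ j × 3 ≤ j + 2 × j + 2 ≤ n + 1 × Factor (b1 ∷ zeros j ++ b1 ∷ []) W))
theorem9 n 1≤n W |W| #1≡2 with count1≡2⇒twoOnes W #1≡2
... | a , b , c , refl =
  ⇔-trans (shuffleSquare⇔split a b c)
    (⇔-trans (split⇔criterion 1≤n (trans (sym (length-twoOnes a b c)) |W|)) criterion⇔factor)
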